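{- Let $(T_r)_{r\in\mathbb{Z}}$ be the Tribonacci numbers and $(K_r)_{r\in\mathbb{Z}}$ the Tribonacci-Lucas numbers. Then for every integer $r$ and every nonnegative integer $k$, \[ \sum_{j=0}^{k}5^{k-j}K_{r-2k-3+2j}=5^{k+1}T_{r-2k-2}-T_r. \]
   Context: The Tribonacci numbers are the two-sided sequence with $T_{ -2}=1$, $T_{ -1}=T_0=0$ and $T_r=T_{r-1}+T_{r-2}+T_{r-3}$ for all $r\in\mathbb{Z}$ (so $T_1=1,T_2=1,T_3=2,\dots$). The Tribonacci-Lucas numbers are the two-sided sequence with $K_{ -2}=K_{ -1}=-1$, $K_0=3$ and $K_r=K_{r-1}+K_{r-2}+K_{r-3}$ for all $r\in\mathbb{Z}$ (so $K_1=1,K_2=3,K_3=7,\dots$). -}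

module Defs where

open import Data.Nat using (ℕ; zero; suc)
open import Data.Integer using (ℤ; +_; -[1+_]; _+_; _-_; _*_; _^_)
open import Data.Product using (_×_; _,_; proj₁)

-- A two-sided integer sequence satisfying X r = X (r-1) + X (r-2) + X (r-3)
-- for all r ∈ ℤ, determined by the three consecutive values (X 0, X 1, X 2).
fwd : ℤ × ℤ × ℤ → ℤ × ℤ × ℤ
fwd (a , b , c) = (b , c , a + b + c)

-- Backward step: (X n, X (n+1), X (n+2)) ↦ (X (n-1), X n, X (n+1)),
-- using X (n-1) = X (n+2) - X (n+1) - X n.
bwd : ℤ × ℤ × ℤ → ℤ × ℤ × ℤ
bwd (a , b , c) = (c - b - a , a , b)

iter : (ℤ × ℤ × ℤ → ℤ × ℤ × ℤ) → ℕ → ℤ × ℤ × ℤ → ℤ × ℤ × ℤ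
iter f zero    w = w
iter f (suc n) w = f (iter f n w)

twoSided : ℤ × ℤ × ℤ → ℤ → ℤ
twoSided w (+ n)     = proj₁ (iter fwd n w)
twoSided w -[1+ n ]  = proj₁ (iter bwd (suc n) w)

-- Tribonacci: T 0 = 0, T 1 = 1, T 2 = 1 (equivalently T(-2)=1, T(-1)=T 0=0).
T : ℤ → ℤ
T = twoSided (+ 0 , + 1 , + 1)

-- Tribonacci-Lucas: K 0 = 3, K 1 = 1, K 2 = 3 (equivalently K(-2)=K(-1)=-1, K 0=3).
K : ℤ → ℤ
K = twoSided (+ 3 , + 1 , + 3)

sumTo : ℕ → (ℕ → ℤ) → ℤ
sumTo zero    f = f zero
sumTo (suc k) f = sumTo k f + f (suc k)

{-# OPTIONS --safe #-}
-- Both sequences live in the three-dimensional space of two-sided solutions of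
-- the recurrence, on which index shift and linear combination act through the
-- initial window.  Comparing windows gives K n = 5 T (n+1) − T (n+3), i.e.
-- 5^(k−j) K (r−2k−3+2j) = F j − F (j+1) with F j = 5^(k+1−j) T (r−2k−2+2j),
-- and the sum telescopes to F 0 − F (k+1).
module Submission where

open import Defs
open import Data.Nat using (ℕ; suc; _∸_) renaming (_*_ to _*ℕ_)
open import Data.Integer using (ℤ; +_; _+_; _-_; _*_; _^_)
open import Relation.Binary.PropositionalEquality using (_≡_)

import Data.Nat as ℕ
import Data.Nat.Properties as ℕ
open import Data.Integer using (-[1+_])
open import Data.Integer.Properties using (+-identityʳ; *-identityˡ; *-comm; pos-+)
open import Data.Integer.Tactic.RingSolver using (solve-∀)
open import Data.Product using (_×_; _,_; proj₁)
open import Relation.Binary.PropositionalEquality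
  using (refl; sym; trans; cong; cong₂; module ≡-Reasoning)

Window : Set
Window = ℤ × ℤ × ℤ

iter-+ : ∀ (f : Window → Window) m n w → iter f (m ℕ.+ n) w ≡ iter f m (iter f n w)
iter-+ f ℕ.zero    n w = refl
iter-+ f (suc m) n w = cong f (iter-+ f m n w)

iter-homomorphic : ∀ (f : Window → Window) (_∙_ : Window → Window → Window) →
  (∀ u v → f (u ∙ v) ≡ f u ∙ f v) →
  ∀ n u v → iter f n (u ∙ v) ≡ iter f n u ∙ iter f n v
iter-homomorphic f _∙_ hom ℕ.zero    u v = refl
iter-homomorphic f _∙_ hom (suc n) u v =
  trans (cong f (iter-homomorphic f _∙_ hom n u v)) (hom (iter f n u) (iter f n v))

bwd∘fwd : ∀ w → bwd (fwd w) ≡ w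
bwd∘fwd (a , b , c) = cong (λ x → x , b , c) (cancel a b c)
  where
  cancel : ∀ a b c → a + b + c - c - b ≡ a
  cancel = solve-∀

iter-bwd-fwd : ∀ n w → iter bwd (suc n) (fwd w) ≡ iter bwd n w
iter-bwd-fwd n w = begin
  iter bwd (suc n) (fwd w)    ≡⟨ cong (λ m → iter bwd m (fwd w)) (ℕ.+-comm 1 n) ⟩
  iter bwd (n ℕ.+ 1) (fwd w)  ≡⟨ iter-+ bwd n 1 (fwd w) ⟩
  iter bwd n (bwd (fwd w))    ≡⟨ cong (iter bwd n) (bwd∘fwd w) ⟩
  iter bwd n w                ∎
  where open ≡-Reasoning

twoSided-fwd : ∀ w n → twoSided (fwd w) n ≡ twoSided w (n + + 1)
twoSided-fwd w (+ m) = cong proj₁ (begin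
  iter fwd m (fwd w)    ≡⟨ sym (iter-+ fwd m 1 w) ⟩
  iter fwd (m ℕ.+ 1) w  ∎)
  where open ≡-Reasoning
twoSided-fwd w -[1+ ℕ.zero ] = cong proj₁ (iter-bwd-fwd 0 w)
twoSided-fwd w -[1+ suc m ]  = cong proj₁ (iter-bwd-fwd (suc m) w)

twoSided-iter-fwd : ∀ k w n → twoSided (iter fwd k w) n ≡ twoSided w (n + + k)
twoSided-iter-fwd ℕ.zero    w n = cong (twoSided w) (sym (+-identityʳ n))
twoSided-iter-fwd (suc k) w n = begin
  twoSided (fwd (iter fwd k w)) n    ≡⟨ twoSided-fwd (iter fwd k w) n ⟩
  twoSided (iter fwd k w) (n + + 1)  ≡⟨ twoSided-iter-fwd k w (n + + 1) ⟩
  twoSided w (n + + 1 + + k)         ≡⟨ cong (twoSided w) (shift n (+ k)) ⟩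
  twoSided w (n + + suc k)           ∎
  where
  open ≡-Reasoning
  shift : ∀ n k → n + + 1 + k ≡ n + (+ 1 + k)
  shift = solve-∀

lincomb : ℤ → Window → Window → Window
lincomb a (u₀ , u₁ , u₂) (v₀ , v₁ , v₂) = (a * u₀ - v₀ , a * u₁ - v₁ , a * u₂ - v₂)

fwd-lincomb : ∀ a u v → fwd (lincomb a u v) ≡ lincomb a (fwd u) (fwd v)
fwd-lincomb a (u₀ , u₁ , u₂) (v₀ , v₁ , v₂) =
  cong (λ x → a * u₁ - v₁ , a * u₂ - v₂ , x) (linear a u₀ u₁ u₂ v₀ v₁ v₂)
  where
  linear : ∀ a u₀ u₁ u₂ v₀ v₁ v₂ →
    (a * u₀ - v₀) + (a * u₁ - v₁) + (a * u₂ - v₂) ≡ a * (u₀ + u₁ + u₂) - (v₀ + v₁ + v₂)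
  linear = solve-∀

bwd-lincomb : ∀ a u v → bwd (lincomb a u v) ≡ lincomb a (bwd u) (bwd v)
bwd-lincomb a (u₀ , u₁ , u₂) (v₀ , v₁ , v₂) =
  cong (λ x → x , a * u₀ - v₀ , a * u₁ - v₁) (linear a u₀ u₁ u₂ v₀ v₁ v₂)
  where
  linear : ∀ a u₀ u₁ u₂ v₀ v₁ v₂ →
    (a * u₂ - v₂) - (a * u₁ - v₁) - (a * u₀ - v₀) ≡ a * (u₂ - u₁ - u₀) - (v₂ - v₁ - v₀)
  linear = solve-∀

twoSided-lincomb : ∀ a u v n → twoSided (lincomb a u v) n ≡ a * twoSided u n - twoSided v n
twoSided-lincomb a u v (+ m) =
  cong proj₁ (iter-homomorphic fwd (lincomb a) (fwd-lincomb a) m u v)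
twoSided-lincomb a u v -[1+ m ] =
  cong proj₁ (iter-homomorphic bwd (lincomb a) (bwd-lincomb a) (suc m) u v)

-- The initial window (3, 1, 3) of K is 5 (1, 1, 2) − (2, 4, 7), built from windows of T.
K≡5T-T : ∀ n → K n ≡ + 5 * T (n + + 1) - T (n + + 3)
K≡5T-T n = begin
  twoSided (lincomb (+ 5) (iter fwd 1 t) (iter fwd 3 t)) n
    ≡⟨ twoSided-lincomb (+ 5) (iter fwd 1 t) (iter fwd 3 t) n ⟩
  + 5 * twoSided (iter fwd 1 t) n - twoSided (iter fwd 3 t) n
    ≡⟨ cong₂ (λ x y → + 5 * x - y) (twoSided-iter-fwd 1 t n) (twoSided-iter-fwd 3 t n) ⟩
  + 5 * T (n + + 1) - T (n + + 3)  ∎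
  where
  open ≡-Reasoning
  t : Window
  t = (+ 0 , + 1 , + 1)

sumTo-cong : ∀ k {f g : ℕ → ℤ} → (∀ j → j ℕ.≤ k → f j ≡ g j) → sumTo k f ≡ sumTo k g
sumTo-cong ℕ.zero    f≗g = f≗g 0 ℕ.z≤n
sumTo-cong (suc k) f≗g =
  cong₂ _+_ (sumTo-cong k (λ j j≤k → f≗g j (ℕ.m≤n⇒m≤1+n j≤k))) (f≗g (suc k) ℕ.≤-refl)

sumTo-telescope : ∀ k (F : ℕ → ℤ) → sumTo k (λ j → F j - F (suc j)) ≡ F 0 - F (suc k)
sumTo-telescope ℕ.zero    F = refl
sumTo-telescope (suc k) F = begin
  sumTo k (λ j → F j - F (suc j)) + (F (suc k) - F (suc (suc k)))
    ≡⟨ cong (_+ (F (suc k) - F (suc (suc k)))) (sumTo-telescope k F) ⟩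
  F 0 - F (suc k) + (F (suc k) - F (suc (suc k)))
    ≡⟨ collapse (F 0) (F (suc k)) (F (suc (suc k))) ⟩
  F 0 - F (suc (suc k))  ∎
  where
  open ≡-Reasoning
  collapse : ∀ a b c → a - b + (b - c) ≡ a - c
  collapse = solve-∀

^-suc-∸ : ∀ a {j k} → j ℕ.≤ k → a ^ (k ∸ j) * a ≡ a ^ (suc k ∸ j)
^-suc-∸ a {j} {k} j≤k = trans (*-comm (a ^ (k ∸ j)) a) (cong (a ^_) (sym (ℕ.+-∸-assoc 1 j≤k)))

+2*suc : ∀ j → + (2 *ℕ suc j) ≡ + (2 *ℕ j) + + 2
+2*suc j = trans (cong +_ (trans (ℕ.*-suc 2 j) (ℕ.+-comm 2 (2 *ℕ j)))) (pos-+ (2 *ℕ j) 2)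

weightedT : ℤ → ℕ → ℕ → ℤ
weightedT r k j = (+ 5) ^ (suc k ∸ j) * T (r - + (2 *ℕ k) - + 2 + + (2 *ℕ j))

K-term≡weightedT-difference : ∀ r {k j} → j ℕ.≤ k →
  (+ 5) ^ (k ∸ j) * K (r - + (2 *ℕ k) - + 3 + + (2 *ℕ j))
    ≡ weightedT r k j - weightedT r k (suc j)
K-term≡weightedT-difference r {k} {j} j≤k = begin
  p * K y                                  ≡⟨ cong (p *_) (K≡5T-T y) ⟩
  p * (+ 5 * T (y + + 1) - T (y + + 3))    ≡⟨ distrib p (T (y + + 1)) (T (y + + 3)) ⟩
  p * + 5 * T (y + + 1) - p * T (y + + 3)
    ≡⟨ cong₂ (λ a b → p * + 5 * T a - p * T b) (index-1 r i l) index-3 ⟩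
  p * + 5 * T (m + l) - weightedT r k (suc j)
    ≡⟨ cong (λ q → q * T (m + l) - weightedT r k (suc j)) (^-suc-∸ (+ 5) j≤k) ⟩
  weightedT r k j - weightedT r k (suc j)  ∎
  where
  open ≡-Reasoning
  p i l m y : ℤ
  p = (+ 5) ^ (k ∸ j)
  i = + (2 *ℕ k)
  l = + (2 *ℕ j)
  m = r - i - + 2
  y = r - i - + 3 + l
  distrib : ∀ p a b → p * (+ 5 * a - b) ≡ p * + 5 * a - p * b
  distrib = solve-∀
  index-1 : ∀ r i l → r - i - + 3 + l + + 1 ≡ r - i - + 2 + l
  index-1 = solve-∀
  shift-3 : ∀ r i l → r - i - + 3 + l + + 3 ≡ r - i - + 2 + (l + + 2)
  shift-3 = solve-∀
  index-3 : y + + 3 ≡ m + + (2 *ℕ suc j)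
  index-3 = trans (shift-3 r i l) (cong (λ z → m + z) (sym (+2*suc j)))

weightedT-first : ∀ r k → weightedT r k 0 ≡ (+ 5) ^ (suc k) * T (r - + (2 *ℕ k) - + 2)
weightedT-first r k = cong (λ y → (+ 5) ^ (suc k) * T y) (+-identityʳ (r - + (2 *ℕ k) - + 2))

weightedT-last : ∀ r k → weightedT r k (suc k) ≡ T r
weightedT-last r k = begin
  (+ 5) ^ (k ∸ k) * T (r - i - + 2 + + (2 *ℕ suc k))
    ≡⟨ cong₂ (λ e z → (+ 5) ^ e * T (r - i - + 2 + z)) (ℕ.n∸n≡0 k) (+2*suc k) ⟩
  + 1 * T (r - i - + 2 + (i + + 2))  ≡⟨ *-identityˡ _ ⟩
  T (r - i - + 2 + (i + + 2))        ≡⟨ cong T (restore r i) ⟩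
  T r                                 ∎
  where
  open ≡-Reasoning
  i : ℤ
  i = + (2 *ℕ k)
  restore : ∀ r i → r - i - + 2 + (i + + 2) ≡ r
  restore = solve-∀

theorem6 : (r : ℤ) (k : ℕ) →
    sumTo k (λ j → (+ 5) ^ (k ∸ j) * K (r - + (2 *ℕ k) - + 3 + + (2 *ℕ j)))
      ≡ (+ 5) ^ (suc k) * T (r - + (2 *ℕ k) - + 2) - T r
theorem6 r k = begin
  sumTo k (λ j → (+ 5) ^ (k ∸ j) * K (r - + (2 *ℕ k) - + 3 + + (2 *ℕ j)))
    ≡⟨ sumTo-cong k (λ j → K-term≡weightedT-difference r) ⟩
  sumTo k (λ j → F j - F (suc j))
    ≡⟨ sumTo-telescope k F ⟩
  F 0 - F (suc k)
    ≡⟨ cong₂ _-_ (weightedT-first r k) (weightedT-last r k) ⟩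
  (+ 5) ^ (suc k) * T (r - + (2 *ℕ k) - + 2) - T r  ∎
  where
  open ≡-Reasoning
  F : ℕ → ℤ
  F = weightedT r k
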